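{- Let $F$ be the Fibonacci sequence with $F(0)=0$, $F(1)=1$, $F(m)=F(m-1)+F(m-2)$. Let $P_3$ be the POP of size 3 with single relation $1>3$ and $P_4$ the POP of size 4 with single relation $1>3$. Then $|Av_n(P_4)|=nF(n)$ for all $n\geq 1$. Moreover, for $n\geq 4$, $Av_n(P_4)=A_n\sqcup B_n\sqcup C_n\sqcup D_n$ (disjoint union), where \begin{align*} A_n&=\{12[1,\sigma] : \sigma\in Av_{n-1}(P_4)\}, & B_n&=\{12[21,\sigma] : \sigma\in Av_{n-2}(P_4)\},\\ C_n&=\{21[\sigma,1] : \sigma\in Av_{n-1}(P_3)\}, & D_n&=\{3142[1,1,\sigma,1] : \sigma\in Av_{n-3}(P_3)\}. \end{align*}
   Context: An $n$-permutation contains a POP of size $k$ (a poset on $\{1,\dots,k\}$) if there are indices $i_1<\cdots<i_k$ with $\pi_{i_a}<\pi_{i_b}$ whenever $a<b$ in the poset. So $\pi$ contains $P_3$ iff there are $i_1<i_2<i_3$ with $\pi_{i_1}>\pi_{i_3}$, and contains $P_4$ iff there are $i_1<i_2<i_3<i_4$ with $\pi_{i_1}>\pi_{i_3}$. $Av_m(\cdot)$ is the set of $m$-permutations avoiding the POP. The inflation $\tau[\alpha^{(1)},\dots,\alpha^{(k)}]$ of a $k$-permutation $\tau$ replaces each entry $\tau_\ell$ by a block of consecutive positions order-isomorphic to $\alpha^{(\ell)}$ whose values form an interval, the blocks ordered relative to each other as the entries of $\tau$. -}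

module Defs where

open import Data.Nat using (ℕ; zero; suc; _+_; _∸_; _<_; _<ᵇ_)
open import Data.Fin using (Fin) renaming (_<_ to _<ᶠ_)
open import Data.Fin.Patterns using (0F; 1F; 2F)
open import Data.Bool using (if_then_else_)
open import Data.Nat.ListAction using (sum)
open import Data.List using (List; []; _∷_; length; map; zip; concatMap; upTo; lookup)
open import Data.List.Membership.Propositional using (_∈_)
open import Data.List.Relation.Binary.Permutation.Propositional using (_↭_)
open import Data.Product using (Σ; ∃; _×_; _,_)
open import Relation.Nullary using (¬_)
open import Relation.Binary.PropositionalEquality using (_≡_)

fib : ℕ → ℕ
fib zero = 0
fib (suc zero) = 1
fib (suc (suc m)) = fib (suc m) + fib m

-- A permutation of size m is represented as a list of naturals (its one-line
-- notation, values 0,…,m-1) that is a rearrangement of [0,…,m-1].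
IsPerm : ℕ → List ℕ → Set
IsPerm m π = π ↭ upTo m

-- A partially ordered pattern (POP) of size k, given by a list of relations
-- (a , b) meaning a <_P b  (elements 0,…,k-1 stand for 1,…,k).
record POP : Set where
  constructor pop
  field
    size : ℕ
    rels : List (Fin size × Fin size)

open POP public

Contains : POP → List ℕ → Set
Contains P π =
  Σ (Fin (size P) → Fin (length π)) λ e →
    (∀ a b → a <ᶠ b → e a <ᶠ e b) ×
    (∀ a b → (a , b) ∈ rels P → lookup π (e a) < lookup π (e b))

Av : ℕ → POP → List ℕ → Set
Av m P π = IsPerm m π × ¬ Contains P π

P3 : POP
P3 = pop 3 ((2F , 0F) ∷ [])

P4 : POP
P4 = pop 4 ((2F , 0F) ∷ [])

-- Inflation τ[α₁,…,α_k]: block ℓ is α_ℓ shifted by the total size of the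
-- blocks α_j with τ_j < τ_ℓ.
private
  offset : ℕ → List (ℕ × List ℕ) → ℕ
  offset t ps = sum (map (λ { (s , α) → if s <ᵇ t then length α else 0 }) ps)

inflate : List ℕ → List (List ℕ) → List ℕ
inflate τ αs =
  let ps = zip τ αs in
  concatMap (λ { (t , α) → map (_+ offset t ps) α }) ps

p1 p12 p21 p3142 : List ℕ
p1 = 0 ∷ []
p12 = 0 ∷ 1 ∷ []
p21 = 1 ∷ 0 ∷ []
p3142 = 2 ∷ 0 ∷ 3 ∷ 1 ∷ []

A B C D : ℕ → List ℕ → Set
A n π = ∃ λ σ → Av (n ∸ 1) P4 σ × π ≡ inflate p12 (p1 ∷ σ ∷ [])
B n π = ∃ λ σ → Av (n ∸ 2) P4 σ × π ≡ inflate p12 (p21 ∷ σ ∷ [])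
C n π = ∃ λ σ → Av (n ∸ 1) P3 σ × π ≡ inflate p21 (σ ∷ p1 ∷ [])
D n π = ∃ λ σ → Av (n ∸ 3) P3 σ × π ≡ inflate p3142 (p1 ∷ p1 ∷ σ ∷ p1 ∷ [])

-- Let P be the POP of size 3 + t with the single relation 1 > 3 (t = 0: P3, t = 1: P4).
-- Choosing the positions a, a + 1, c, c + 1, …, c + t shows that π avoids P exactly when no
-- entry at a position c ≥ a + 2 followed by at least t further positions lies below π(a).
-- For t ≤ 1 this pins down the smallest values: 0 comes first, or 1 0 comes first, or (only
-- for t = 1) 0 comes last, or 2 0 comes first and 1 last; any larger first entry would be
-- undercut by 0, 1 or 2 too early.  Deleting these entries leaves a P-avoider in the first
-- two cases and a P3-avoider in the last two, and conversely.  Hence |Av_m(P3)| = F(m + 1),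
-- and |Av_n(P4)| = (n-1)F(n-1) + (n-2)F(n-2) + F(n) + F(n-2) = nF(n).
module Submission where

open import Defs
open import Data.Nat
open import Data.Nat.Properties
open import Data.Nat.Tactic.RingSolver using (solve-∀)
open import Data.Fin using (Fin; zero; suc; toℕ; fromℕ<) renaming (_<_ to _<ᶠ_)
open import Data.Fin.Properties using (toℕ-fromℕ<; toℕ<n)
open import Data.List hiding ([_])
open import Data.List.Properties using (++-identityʳ; length-++; length-map; length-upTo; map-cong; map-upTo; map-injective; ∷-injectiveʳ; ∷ʳ-injectiveˡ)
open import Data.List.Membership.Propositional using (_∈_)
open import Data.List.Membership.Propositional.Properties using (∈-upTo⁺; ∈-map⁻; ∈-map⁺; ∈-++⁻; ∈-++⁺ˡ; ∈-++⁺ʳ)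
open import Data.List.Relation.Unary.Any using (here; there)
import Data.List.Relation.Unary.All as All
open import Data.List.Relation.Unary.AllPairs using ([]; _∷_)
open import Data.List.Relation.Unary.Unique.Propositional using (Unique)
import Data.List.Relation.Unary.Unique.Propositional.Properties as Unique
open import Data.List.Relation.Binary.Permutation.Propositional using (_↭_; prep; swap; ↭-refl; ↭-sym; ↭-trans; ↭-reflexive; ↭⇒↭ₛ; module PermutationReasoning)
open import Data.List.Relation.Binary.Permutation.Propositional.Properties using (↭-empty-inv; ↭-singleton-inv; ∈-resp-↭; ↭-length; drop-∷; map⁺; ∷↭∷ʳ)
import Data.List.Relation.Binary.Permutation.Setoid.Properties as PermutationSetoid
open import Data.Product using (Σ; ∃; _×_; _,_; proj₁; proj₂; uncurry)
open import Data.Sum using (_⊎_; inj₁; inj₂; [_,_])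
open import Data.Empty using (⊥-elim)
open import Function using (_∘_; id)
open import Function.Bundles using (_⇔_; mk⇔; Equivalence)
import Function.Properties.Equivalence as ⇔
open import Function.Definitions using (Injective)
open import Relation.Nullary using (¬_; yes; no)
open import Relation.Binary.PropositionalEquality hiding ([_])

-- Total indexing: positions past the end read as the junk value 0; it is only used in range.
infixl 20 _‼_
_‼_ : List ℕ → ℕ → ℕ
[]       ‼ _     = 0
(x ∷ xs) ‼ zero  = x
(x ∷ xs) ‼ suc i = xs ‼ i

lookup-‼ : ∀ xs (i : Fin (length xs)) → lookup xs i ≡ xs ‼ toℕ i
lookup-‼ (x ∷ xs) zero    = refl
lookup-‼ (x ∷ xs) (suc i) = lookup-‼ xs i

‼-∈ : ∀ xs {i} → i < length xs → xs ‼ i ∈ xs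
‼-∈ (x ∷ xs) {zero}  _         = here refl
‼-∈ (x ∷ xs) {suc i} (s≤s i<ℓ) = there (‼-∈ xs i<ℓ)

∈⇒‼ : ∀ {x} xs → x ∈ xs → ∃ λ i → i < length xs × xs ‼ i ≡ x
∈⇒‼ (y ∷ ys) (here refl) = 0 , s≤s z≤n , refl
∈⇒‼ (y ∷ ys) (there x∈) with i , i<ℓ , eq ← ∈⇒‼ ys x∈ = suc i , s≤s i<ℓ , eq

‼-map : ∀ f xs {i} → i < length xs → map f xs ‼ i ≡ f (xs ‼ i)
‼-map f (x ∷ xs) {zero}  _         = refl
‼-map f (x ∷ xs) {suc i} (s≤s i<ℓ) = ‼-map f xs i<ℓ

‼-++ˡ : ∀ xs ys {i} → i < length xs → (xs ++ ys) ‼ i ≡ xs ‼ i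
‼-++ˡ (x ∷ xs) ys {zero}  _         = refl
‼-++ˡ (x ∷ xs) ys {suc i} (s≤s i<ℓ) = ‼-++ˡ xs ys i<ℓ

‼-∷ʳ-last : ∀ xs y → (xs ∷ʳ y) ‼ length xs ≡ y
‼-∷ʳ-last []       y = refl
‼-∷ʳ-last (x ∷ xs) y = ‼-∷ʳ-last xs y

length-∷ʳ : ∀ (xs : List ℕ) y → length (xs ∷ʳ y) ≡ suc (length xs)
length-∷ʳ xs y = trans (length-++ xs) (+-comm (length xs) 1)

Unique⇒‼-injective : ∀ {xs} → Unique xs → ∀ {i j} → i < length xs → j < length xs → xs ‼ i ≡ xs ‼ j → i ≡ j
Unique⇒‼-injective {x ∷ xs} (x∉ ∷ u) {zero}  {zero}  _         _         _  = refl
Unique⇒‼-injective {x ∷ xs} (x∉ ∷ u) {zero}  {suc j} _         (s≤s j<ℓ) eq = ⊥-elim (All.lookup x∉ (‼-∈ xs j<ℓ) eq)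
Unique⇒‼-injective {x ∷ xs} (x∉ ∷ u) {suc i} {zero}  (s≤s i<ℓ) _         eq = ⊥-elim (All.lookup x∉ (‼-∈ xs i<ℓ) (sym eq))
Unique⇒‼-injective {x ∷ xs} (x∉ ∷ u) {suc i} {suc j} (s≤s i<ℓ) (s≤s j<ℓ) eq = cong suc (Unique⇒‼-injective u i<ℓ j<ℓ eq)

Unique-resp-↭ : ∀ {xs ys : List ℕ} → xs ↭ ys → Unique xs → Unique ys
Unique-resp-↭ xs↭ys = PermutationSetoid.Unique-resp-↭ (setoid ℕ) (↭⇒↭ₛ xs↭ys)

module _ {n π} (π↭ : IsPerm n π) where

  perm-length : length π ≡ n
  perm-length = trans (↭-length π↭) (length-upTo n)

  perm-position : ∀ {x} → x < n → ∃ λ i → i < n × π ‼ i ≡ x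
  perm-position x<n with i , i<ℓ , eq ← ∈⇒‼ π (∈-resp-↭ (↭-sym π↭) (∈-upTo⁺ x<n)) =
    i , subst (i <_) perm-length i<ℓ , eq

  perm-injective : ∀ {i j} → i < n → j < n → π ‼ i ≡ π ‼ j → i ≡ j
  perm-injective i<n j<n =
    Unique⇒‼-injective (Unique-resp-↭ (↭-sym π↭) (Unique.upTo⁺ n)) (in-range i<n) (in-range j<n)
    where
    in-range : ∀ {i} → i < n → i < length π
    in-range = subst (_ <_) (sym perm-length)

applyUpTo-+ : ∀ (f : ℕ → ℕ) k m → applyUpTo f (k + m) ≡ applyUpTo f k ++ applyUpTo (λ i → f (k + i)) m
applyUpTo-+ f zero    m = refl
applyUpTo-+ f (suc k) m = cong (f 0 ∷_) (applyUpTo-+ (f ∘ suc) k m)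

upTo-+ : ∀ k m → upTo (k + m) ≡ upTo k ++ map (_+ k) (upTo m)
upTo-+ k m = begin
  upTo (k + m)                   ≡⟨ applyUpTo-+ id k m ⟩
  upTo k ++ applyUpTo (k +_) m   ≡⟨ cong (upTo k ++_) (sym (map-upTo (k +_) m)) ⟩
  upTo k ++ map (k +_) (upTo m)  ≡⟨ cong (upTo k ++_) (map-cong (+-comm k) (upTo m)) ⟩
  upTo k ++ map (_+ k) (upTo m)  ∎
  where open ≡-Reasoning

↭-map-+⁻ : ∀ k {xs ys} → xs ↭ map (_+ k) ys → ∃ λ σ → σ ↭ ys × xs ≡ map (_+ k) σ
↭-map-+⁻ k {xs} {ys} xs↭ =
  map (_∸ k) xs , subst (map (_∸ k) xs ↭_) (∸-+ ys) (map⁺ _ xs↭) , sym (+-∸ xs k≤)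
  where
  ∸-+ : ∀ zs → map (_∸ k) (map (_+ k) zs) ≡ zs
  ∸-+ []       = refl
  ∸-+ (z ∷ zs) = cong₂ _∷_ (m+n∸n≡m z k) (∸-+ zs)
  +-∸ : ∀ zs → (∀ {z} → z ∈ zs → k ≤ z) → map (_+ k) (map (_∸ k) zs) ≡ zs
  +-∸ []       _   = refl
  +-∸ (z ∷ zs) k≤z = cong₂ _∷_ (m∸n+n≡m (k≤z (here refl))) (+-∸ zs (k≤z ∘ there))
  k≤ : ∀ {z} → z ∈ xs → k ≤ z
  k≤ z∈ with y , _ , refl ← ∈-map⁻ (_+ k) (∈-resp-↭ xs↭ z∈) = m≤n+m k y

‼-map-+-≥ : ∀ k xs {j} → j < length xs → k ≤ map (_+ k) xs ‼ j
‼-map-+-≥ k xs j<ℓ = subst (k ≤_) (sym (‼-map (_+ k) xs j<ℓ)) (m≤n+m k _)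

record NoSpacedInversion (t : ℕ) (π : List ℕ) : Set where
  field
    spaced-≮ : ∀ a c → 2 + a ≤ c → t + suc c ≤ length π → ¬ (π ‼ c < π ‼ a)

open NoSpacedInversion

spaced-in-range : ∀ {t a c ℓ} → 2 + a ≤ c → t + suc c ≤ ℓ → a < ℓ × c < ℓ
spaced-in-range {t} {a} {c} {ℓ} a+2≤c late = <-trans (≤-trans (n≤1+n _) a+2≤c) c<ℓ , c<ℓ
  where
  c<ℓ : c < ℓ
  c<ℓ = ≤-trans (s≤s (m≤n+m c t)) (subst (_≤ ℓ) (+-suc t c) late)

nsi-tail : ∀ {t x τ} → NoSpacedInversion t (x ∷ τ) → NoSpacedInversion t τ
spaced-≮ (nsi-tail {t} {τ = τ} nsi) a c a+2≤c late =
  spaced-≮ nsi (suc a) (suc c) (s≤s a+2≤c) (subst (_≤ suc (length τ)) (sym (+-suc t (suc c))) (s≤s late))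

nsi-cons : ∀ {t x τ} → NoSpacedInversion t τ →
           (∀ j → t + suc (suc j) ≤ length τ → ¬ (τ ‼ suc j < x)) → NoSpacedInversion t (x ∷ τ)
spaced-≮ (nsi-cons {t} {τ = τ} nsi x≤) zero    (suc (suc j)) _           late =
  x≤ j (≤-pred (subst (_≤ suc (length τ)) (+-suc t (suc (suc j))) late))
spaced-≮ (nsi-cons {t} {τ = τ} nsi x≤) (suc a) (suc c)       (s≤s a+2≤c) late =
  spaced-≮ nsi a c a+2≤c (≤-pred (subst (_≤ suc (length τ)) (+-suc t (suc c)) late))
spaced-≮ (nsi-cons             nsi x≤) zero    (suc zero)    (s≤s ())

nsi-map⁺ : ∀ {t f σ} → (∀ {x y} → f x < f y → x < y) → NoSpacedInversion t σ → NoSpacedInversion t (map f σ)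
spaced-≮ (nsi-map⁺ {t} {f} {σ} reflects nsi) a c a+2≤c late fc<fa =
  spaced-≮ nsi a c a+2≤c late′ (reflects (subst₂ _<_ (‼-map f σ (proj₂ bounds)) (‼-map f σ (proj₁ bounds)) fc<fa))
  where
  late′ : t + suc c ≤ length σ
  late′ = subst (t + suc c ≤_) (length-map f σ) late
  bounds = spaced-in-range {t} a+2≤c late′

nsi-map⁻ : ∀ {t f σ} → (∀ {x y} → x < y → f x < f y) → NoSpacedInversion t (map f σ) → NoSpacedInversion t σ
spaced-≮ (nsi-map⁻ {t} {f} {σ} preserves nsi) a c a+2≤c late c<a =
  spaced-≮ nsi a c a+2≤c (subst (t + suc c ≤_) (sym (length-map f σ)) late)
    (subst₂ _<_ (sym (‼-map f σ (proj₂ bounds))) (sym (‼-map f σ (proj₁ bounds))) (preserves c<a))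
  where
  bounds = spaced-in-range {t} a+2≤c late

nsi-∷ʳ⁺ : ∀ {t M} y → NoSpacedInversion t M → NoSpacedInversion (suc t) (M ∷ʳ y)
spaced-≮ (nsi-∷ʳ⁺ {t} {M} y nsi) a c a+2≤c late c<a =
  spaced-≮ nsi a c a+2≤c late′ (subst₂ _<_ (‼-++ˡ M _ (proj₂ bounds)) (‼-++ˡ M _ (proj₁ bounds)) c<a)
  where
  late′ : t + suc c ≤ length M
  late′ = ≤-pred (subst (suc (t + suc c) ≤_) (length-∷ʳ M y) late)
  bounds = spaced-in-range {t} a+2≤c late′

nsi-∷ʳ⁻ : ∀ {t M} y → NoSpacedInversion (suc t) (M ∷ʳ y) → NoSpacedInversion t M
spaced-≮ (nsi-∷ʳ⁻ {t} {M} y nsi) a c a+2≤c late c<a =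
  spaced-≮ nsi a c a+2≤c (subst (suc (t + suc c) ≤_) (sym (length-∷ʳ M y)) (s≤s late))
    (subst₂ _<_ (sym (‼-++ˡ M _ (proj₂ bounds))) (sym (‼-++ˡ M _ (proj₁ bounds))) c<a)
  where
  bounds = spaced-in-range {t} a+2≤c late

-- P3 and P4 are dropPOP 0 and dropPOP 1 definitionally.
dropPOP : ℕ → POP
dropPOP t = pop (3 + t) ((suc (suc zero) , zero) ∷ [])

StrictlyIncreasing : ∀ {k n} → (Fin k → Fin n) → Set
StrictlyIncreasing e = ∀ a b → a <ᶠ b → e a <ᶠ e b

increasing-spread : ∀ {k n} (e : Fin (suc k) → Fin n) → StrictlyIncreasing e → toℕ (e zero) + k < n
increasing-spread {zero}  e _    = subst (_< _) (sym (+-identityʳ _)) (toℕ<n (e zero))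
increasing-spread {suc k} e incr = begin-strict
  toℕ (e zero) + suc k    ≡⟨ +-suc (toℕ (e zero)) k ⟩
  suc (toℕ (e zero)) + k  ≤⟨ +-monoˡ-≤ k (incr zero (suc zero) (s≤s z≤n)) ⟩
  toℕ (e (suc zero)) + k  <⟨ increasing-spread (e ∘ suc) (λ a b a<b → incr (suc a) (suc b) (s≤s a<b)) ⟩
  _                       ∎
  where open ≤-Reasoning

short-avoids : ∀ {k} rels π → length π ≤ k → ¬ Contains (pop (suc k) rels) π
short-avoids {k} _ _ ℓ≤k (e , incr , _) = <⇒≱ (≤-<-trans (m≤n+m k _) (increasing-spread e incr)) ℓ≤k

contains⇒spacedInversion : ∀ t π → Contains (dropPOP t) π → ¬ NoSpacedInversion t π
contains⇒spacedInversion t π (e , incr , rel) nsi = spaced-≮ nsi (toℕ (e zero)) (toℕ (e 2F)) a+2≤c late c<a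
  where
  2F : Fin (3 + t)
  2F = suc (suc zero)
  a+2≤c : 2 + toℕ (e zero) ≤ toℕ (e 2F)
  a+2≤c = ≤-trans (s≤s (incr zero (suc zero) (s≤s z≤n))) (incr (suc zero) 2F (s≤s (s≤s z≤n)))
  late : t + suc (toℕ (e 2F)) ≤ length π
  late = subst (_≤ length π) (trans (cong suc (+-comm (toℕ (e 2F)) t)) (sym (+-suc t _)))
    (increasing-spread (λ i → e (suc (suc i))) (λ a b a<b → incr (suc (suc a)) (suc (suc b)) (s≤s (s≤s a<b))))
  c<a : π ‼ toℕ (e 2F) < π ‼ toℕ (e zero)
  c<a = subst₂ _<_ (lookup-‼ π (e 2F)) (lookup-‼ π (e zero)) (rel 2F zero (here refl))

avoids⇒noSpacedInversion : ∀ t π → ¬ Contains (dropPOP t) π → NoSpacedInversion t π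
spaced-≮ (avoids⇒noSpacedInversion t π avoids) a c a+2≤c late c<a = avoids (e , incr , rel)
  where
  pos : Fin (3 + t) → ℕ
  pos zero          = a
  pos (suc zero)    = suc a
  pos (suc (suc j)) = toℕ j + c
  c<ℓ : c < length π
  c<ℓ = proj₂ (spaced-in-range {t} a+2≤c late)
  pos<ℓ : ∀ i → pos i < length π
  pos<ℓ zero          = proj₁ (spaced-in-range {t} a+2≤c late)
  pos<ℓ (suc zero)    = <-trans a+2≤c c<ℓ
  pos<ℓ (suc (suc j)) = ≤-trans (s≤s (+-monoˡ-≤ c (≤-pred (toℕ<n j)))) (subst (_≤ length π) (+-suc t c) late)
  pos-increasing : ∀ i j → i <ᶠ j → pos i < pos j
  pos-increasing zero          (suc zero)    _ = n<1+n a
  pos-increasing zero          (suc (suc j)) _ = <-≤-trans (≤-trans (n≤1+n _) a+2≤c) (m≤n+m c (toℕ j))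
  pos-increasing (suc zero)    (suc (suc j)) _ = ≤-trans a+2≤c (m≤n+m c (toℕ j))
  pos-increasing (suc (suc i)) (suc (suc j)) (s≤s (s≤s i<j)) = +-monoˡ-< c i<j
  pos-increasing (suc zero)    (suc zero)    (s≤s ())
  pos-increasing (suc (suc i)) (suc zero)    (s≤s ())
  e : Fin (3 + t) → Fin (length π)
  e i = fromℕ< (pos<ℓ i)
  at : ∀ i → lookup π (e i) ≡ π ‼ pos i
  at i = trans (lookup-‼ π (e i)) (cong (π ‼_) (toℕ-fromℕ< (pos<ℓ i)))
  incr : StrictlyIncreasing e
  incr i j i<j = subst₂ _<_ (sym (toℕ-fromℕ< _)) (sym (toℕ-fromℕ< _)) (pos-increasing i j i<j)
  rel : ∀ i j → (i , j) ∈ rels (dropPOP t) → lookup π (e i) < lookup π (e j)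
  rel _ _ (here refl) = subst₂ _<_ (sym (at _)) (sym (at zero)) c<a

AvNSI : ℕ → ℕ → List ℕ → Set
AvNSI t m π = IsPerm m π × NoSpacedInversion t π

Av⇒AvNSI : ∀ {t m π} → Av m (dropPOP t) π → AvNSI t m π
Av⇒AvNSI {t} {π = π} (π↭ , avoids) = π↭ , avoids⇒noSpacedInversion t π avoids

AvNSI⇒Av : ∀ {t m π} → AvNSI t m π → Av m (dropPOP t) π
AvNSI⇒Av {t} {π = π} (π↭ , nsi) = π↭ , λ contains → contains⇒spacedInversion t π contains nsi

Image : (List ℕ → List ℕ) → (List ℕ → Set) → List ℕ → Set
Image f Q π = ∃ λ σ → Q σ × π ≡ f σ

shapeA shapeB shapeC shapeD : List ℕ → List ℕ
shapeA σ = inflate p12 (p1 ∷ σ ∷ [])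
shapeB σ = inflate p12 (p21 ∷ σ ∷ [])
shapeC σ = inflate p21 (σ ∷ p1 ∷ [])
shapeD σ = inflate p3142 (p1 ∷ p1 ∷ σ ∷ p1 ∷ [])

shapeA-≡ : ∀ σ → shapeA σ ≡ 0 ∷ map (_+ 1) σ
shapeA-≡ σ = cong (0 ∷_) (++-identityʳ _)

shapeB-≡ : ∀ σ → shapeB σ ≡ 1 ∷ 0 ∷ map (_+ 2) σ
shapeB-≡ σ = cong (λ τ → 1 ∷ 0 ∷ τ) (++-identityʳ _)

+-cancelʳ : ∀ k {x y} → x + k < y + k → x < y
+-cancelʳ k = +-cancelʳ-< k _ _

shapeA⁺ : ∀ {t m σ} → AvNSI t m σ → AvNSI t (suc m) (shapeA σ)
shapeA⁺ {t} {m} {σ} (σ↭ , nsi) = subst (AvNSI t (suc m)) (sym (shapeA-≡ σ))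
  ( ↭-trans (prep 0 (map⁺ _ σ↭)) (↭-reflexive (sym (upTo-+ 1 m)))
  , nsi-cons (nsi-map⁺ (+-cancelʳ 1) nsi) (λ _ _ ()))

shapeA⁻ : ∀ {t m π} → AvNSI t (suc m) π → π ‼ 0 ≡ 0 → Image shapeA (AvNSI t m) π
shapeA⁻ {m = m} {π = []} (π↭ , _) _ with () ← perm-length π↭
shapeA⁻ {t} {m} {0 ∷ ρ} (π↭ , nsi) refl
  with σ , σ↭ , refl ← ↭-map-+⁻ 1 (drop-∷ (↭-trans π↭ (↭-reflexive (upTo-+ 1 m)))) =
  σ , (σ↭ , nsi-map⁻ (+-monoˡ-< 1) (nsi-tail nsi)) , sym (shapeA-≡ σ)

shapeB⁺ : ∀ {t m σ} → AvNSI t m σ → AvNSI t (2 + m) (shapeB σ)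
shapeB⁺ {t} {m} {σ} (σ↭ , nsi) = subst (AvNSI t (2 + m)) (sym (shapeB-≡ σ))
  ( ↭-trans (swap 1 0 (map⁺ _ σ↭)) (↭-reflexive (sym (upTo-+ 2 m)))
  , nsi-cons (nsi-cons (nsi-map⁺ (+-cancelʳ 2) nsi) (λ _ _ ())) entries≥2)
  where
  entries≥2 : ∀ j → t + suc (suc j) ≤ suc (length (map (_+ 2) σ)) → ¬ (map (_+ 2) σ ‼ j < 1)
  entries≥2 j late = ≤⇒≯ (≤-trans (s≤s z≤n) (‼-map-+-≥ 2 σ j<ℓ))
    where
    j<ℓ : j < length σ
    j<ℓ = ≤-pred (subst (suc (suc j) ≤_) (cong suc (length-map _ σ)) (≤-trans (m≤n+m _ t) late))

shapeB⁻ : ∀ {t m π} → AvNSI t (2 + m) π → π ‼ 0 ≡ 1 → π ‼ 1 ≡ 0 → Image shapeB (AvNSI t m) π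
shapeB⁻ {π = []}    (π↭ , _) _ _ with () ← perm-length π↭
shapeB⁻ {π = _ ∷ []} (π↭ , _) _ _ with () ← perm-length π↭
shapeB⁻ {t} {m} {1 ∷ 0 ∷ ρ} (π↭ , nsi) refl refl
  with σ , σ↭ , refl ← ↭-map-+⁻ 2 (drop-∷ (drop-∷ (↭-trans (swap 0 1 ↭-refl) (↭-trans π↭ (↭-reflexive (upTo-+ 2 m)))))) =
  σ , (σ↭ , nsi-map⁻ (+-monoˡ-< 2) (nsi-tail (nsi-tail nsi))) , sym (shapeB-≡ σ)

shapeC⁺ : ∀ {m σ} → AvNSI 0 m σ → AvNSI 1 (suc m) (shapeC σ)
shapeC⁺ {m} {σ} (σ↭ , nsi) =
  ↭-trans (↭-sym (∷↭∷ʳ 0 (map (_+ 1) σ))) (↭-trans (prep 0 (map⁺ _ σ↭)) (↭-reflexive (sym (upTo-+ 1 m))))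
  , nsi-∷ʳ⁺ 0 (nsi-map⁺ (+-cancelʳ 1) nsi)

shapeC⁻ : ∀ {m π} → AvNSI 1 (suc m) π → π ‼ m ≡ 0 → Image shapeC (AvNSI 0 m) π
shapeC⁻ {m} {π} (π↭ , nsi) π‼m≡0 with initLast π
... | [] with () ← perm-length π↭
... | M ∷ʳ′ y with refl ← suc-injective (trans (sym (length-∷ʳ M y)) (perm-length π↭))
  with refl ← trans (sym (‼-∷ʳ-last M y)) π‼m≡0
  with σ , σ↭ , refl ← ↭-map-+⁻ 1 (drop-∷ (↭-trans (∷↭∷ʳ 0 M) (↭-trans π↭ (↭-reflexive (upTo-+ 1 m))))) =
  σ , (σ↭ , nsi-map⁻ (+-monoˡ-< 1) (nsi-∷ʳ⁻ 0 nsi)) , refl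

201↭012 : ∀ M → 2 ∷ 0 ∷ (M ∷ʳ 1) ↭ 0 ∷ 1 ∷ 2 ∷ M
201↭012 M = begin
  2 ∷ 0 ∷ (M ∷ʳ 1) ↭⟨ prep 2 (prep 0 (↭-sym (∷↭∷ʳ 1 M))) ⟩
  2 ∷ 0 ∷ 1 ∷ M    ↭⟨ swap 2 0 ↭-refl ⟩
  0 ∷ 2 ∷ 1 ∷ M    ↭⟨ prep 0 (swap 2 1 ↭-refl) ⟩
  0 ∷ 1 ∷ 2 ∷ M    ∎
  where open PermutationReasoning

shapeD⁺ : ∀ {m σ} → AvNSI 0 m σ → AvNSI 1 (3 + m) (shapeD σ)
shapeD⁺ {m} {σ} (σ↭ , nsi) =
  ↭-trans (201↭012 M) (↭-trans (prep 0 (prep 1 (prep 2 (map⁺ _ σ↭)))) (↭-reflexive (sym (upTo-+ 3 m))))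
  , nsi-cons (nsi-cons (nsi-∷ʳ⁺ 1 (nsi-map⁺ (+-cancelʳ 3) nsi)) (λ _ _ ())) entries≥3
  where
  M = map (_+ 3) σ
  entries≥3 : ∀ j → 1 + suc (suc j) ≤ suc (length (M ∷ʳ 1)) → ¬ ((M ∷ʳ 1) ‼ j < 2)
  entries≥3 j late = ≤⇒≯ (≤-trans (n≤1+n 2) (subst (3 ≤_) (sym (‼-++ˡ M _ j<ℓ)) (‼-map-+-≥ 3 σ (subst (j <_) (length-map _ σ) j<ℓ))))
    where
    j<ℓ : j < length M
    j<ℓ = ≤-pred (subst (suc (suc j) ≤_) (length-∷ʳ M 1) (≤-pred late))

shapeD⁻ : ∀ {m π} → AvNSI 1 (3 + m) π → π ‼ 0 ≡ 2 → π ‼ 1 ≡ 0 → π ‼ (2 + m) ≡ 1 → Image shapeD (AvNSI 0 m) π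
shapeD⁻ {π = []}    (π↭ , _) _ _ _ with () ← perm-length π↭
shapeD⁻ {π = _ ∷ []} (π↭ , _) _ _ _ with () ← perm-length π↭
shapeD⁻ {m} {2 ∷ 0 ∷ ρ} (π↭ , nsi) refl refl ρ‼m≡1 with initLast ρ
... | [] with () ← perm-length π↭
... | M ∷ʳ′ y with refl ← suc-injective (suc-injective (suc-injective (trans (cong (2 +_) (sym (length-∷ʳ M y))) (perm-length π↭))))
  with refl ← trans (sym (‼-∷ʳ-last M y)) ρ‼m≡1
  with σ , σ↭ , refl ← ↭-map-+⁻ 3 (drop-∷ (drop-∷ (drop-∷ (↭-trans (↭-sym (201↭012 M)) (↭-trans π↭ (↭-reflexive (upTo-+ 3 m))))))) =
  σ , (σ↭ , nsi-map⁻ (+-monoˡ-< 3) (nsi-∷ʳ⁻ 1 (nsi-tail (nsi-tail nsi)))) , refl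

data SmallEntries (t k : ℕ) (π : List ℕ) : Set where
  startsWith0        : π ‼ 0 ≡ 0 → SmallEntries t k π
  startsWith10       : π ‼ 0 ≡ 1 → π ‼ 1 ≡ 0 → SmallEntries t k π
  startsWith20-ends1 : t ≡ 1 → π ‼ 0 ≡ 2 → π ‼ 1 ≡ 0 → π ‼ k ≡ 1 → SmallEntries t k π
  endsWith0          : t ≡ 1 → π ‼ k ≡ 0 → SmallEntries t k π

module Placement {t k π} (t≤1 : t ≤ 1) (π↭ : IsPerm (suc k) π) (nsi : NoSpacedInversion t π) where

  below-first : ∀ {c} → 2 ≤ c → c < suc k → π ‼ c < π ‼ 0 → t ≡ 1 × c ≡ k
  below-first {c} 2≤c c<n c<0 with t + suc c ≤? suc k
  ... | yes late = ⊥-elim (spaced-≮ nsi 0 c 2≤c (subst (t + suc c ≤_) (sym (perm-length π↭)) late) c<0)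
  ... | no ¬late = at-end t≤1 (≰⇒> ¬late)
    where
    at-end : ∀ {t} → t ≤ 1 → suc k < t + suc c → t ≡ 1 × c ≡ k
    at-end {zero}        _        k<c = ⊥-elim (<⇒≱ (≤-pred k<c) (≤-pred c<n))
    at-end {suc zero}    _        k<c = refl , ≤-antisym (≤-pred c<n) (≤-pred (≤-pred k<c))
    at-end {suc (suc _)} (s≤s ())

  first-≢ : ∀ {i x} → suc i < suc k → π ‼ suc i ≡ x → π ‼ 0 ≢ x
  first-≢ i<n π‼i≡x π‼0≡x = 0≢1+n (perm-injective π↭ (s≤s z≤n) i<n (trans π‼0≡x (sym π‼i≡x)))

  no-position-for-2 : 1 < π ‼ 0 → π ‼ 0 ≢ 2 → π ‼ 1 ≡ 0 → π ‼ k ≡ 1 → ∀ r → r < suc k → π ‼ r ≢ 2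
  no-position-for-2 _     π‼0≢2 _     _     zero          _   π‼r≡2 = π‼0≢2 π‼r≡2
  no-position-for-2 _     _     π‼1≡0 _     (suc zero)    _   π‼r≡2 = 0≢1+n (trans (sym π‼1≡0) π‼r≡2)
  no-position-for-2 1<π‼0 π‼0≢2 _     π‼k≡1 (suc (suc r)) r<n π‼r≡2
    with _ , refl ← below-first (s≤s (s≤s z≤n)) r<n (subst (_< π ‼ 0) (sym π‼r≡2) (≤∧≢⇒< 1<π‼0 (≢-sym π‼0≢2)))
    with () ← trans (sym π‼k≡1) π‼r≡2

  second-is-0 : π ‼ 1 ≡ 0 → 1 < suc k → SmallEntries t k π
  second-is-0 π‼1≡0 1<n with perm-position π↭ {1} 1<n
  ... | zero          , _   , π‼0≡1 = startsWith10 π‼0≡1 π‼1≡0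
  ... | suc zero      , _   , π‼1≡1 = ⊥-elim (0≢1+n (trans (sym π‼1≡0) π‼1≡1))
  ... | suc (suc j)   , j<n , π‼j≡1
    with 1<π‼0 ← ≤∧≢⇒< (≤∧≢⇒< z≤n (≢-sym (first-≢ 1<n π‼1≡0))) (≢-sym (first-≢ j<n π‼j≡1))
    with t≡1 , refl ← below-first (s≤s (s≤s z≤n)) j<n (subst (_< π ‼ 0) (sym π‼j≡1) 1<π‼0)
    with π ‼ 0 ≟ 2
  ... | yes π‼0≡2 = startsWith20-ends1 t≡1 π‼0≡2 π‼1≡0 π‼j≡1
  ... | no  π‼0≢2 with r , r<n , π‼r≡2 ← perm-position π↭ {2} (s≤s (s≤s (s≤s z≤n)))
    = ⊥-elim (no-position-for-2 1<π‼0 π‼0≢2 π‼1≡0 π‼j≡1 r r<n π‼r≡2)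

  classify : SmallEntries t k π
  classify with perm-position π↭ {0} (s≤s z≤n)
  ... | zero        , _   , π‼0≡0 = startsWith0 π‼0≡0
  ... | suc zero    , 1<n , π‼1≡0 = second-is-0 π‼1≡0 1<n
  ... | suc (suc i) , i<n , π‼i≡0
    with t≡1 , refl ← below-first (s≤s (s≤s z≤n)) i<n (subst (_< π ‼ 0) (sym π‼i≡0) (n≢0⇒n>0 (first-≢ i<n π‼i≡0)))
    = endsWith0 t≡1 π‼i≡0

Av-image⁺ : ∀ {s t k m f π} → (∀ {σ} → AvNSI s k σ → AvNSI t m (f σ)) →
            Image f (Av k (dropPOP s)) π → Av m (dropPOP t) π
Av-image⁺ shape⁺ (σ , av , refl) = AvNSI⇒Av (shape⁺ (Av⇒AvNSI av))

Av-image⁻ : ∀ {s k f π} → Image f (AvNSI s k) π → Image f (Av k (dropPOP s)) π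
Av-image⁻ (σ , q , eq) = σ , AvNSI⇒Av q , eq

Av-P3-decomposition : ∀ m π → Av (2 + m) P3 π ⇔ (Image shapeA (Av (1 + m) P3) π ⊎ Image shapeB (Av m P3) π)
Av-P3-decomposition m π = mk⇔ to [ Av-image⁺ shapeA⁺ , Av-image⁺ shapeB⁺ ]
  where
  to : Av (2 + m) P3 π → Image shapeA (Av (1 + m) P3) π ⊎ Image shapeB (Av m P3) π
  to av with π↭ , nsi ← Av⇒AvNSI av with Placement.classify z≤n π↭ nsi
  ... | startsWith0 π‼0≡0               = inj₁ (Av-image⁻ (shapeA⁻ (π↭ , nsi) π‼0≡0))
  ... | startsWith10 π‼0≡1 π‼1≡0        = inj₂ (Av-image⁻ (shapeB⁻ (π↭ , nsi) π‼0≡1 π‼1≡0))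
  ... | startsWith20-ends1 () _ _ _
  ... | endsWith0 () _

Av-P4-decomposition : ∀ m π → Av (3 + m) P4 π ⇔ (A (3 + m) π ⊎ B (3 + m) π ⊎ C (3 + m) π ⊎ D (3 + m) π)
Av-P4-decomposition m π =
  mk⇔ to [ Av-image⁺ shapeA⁺ , [ Av-image⁺ shapeB⁺ , [ Av-image⁺ shapeC⁺ , Av-image⁺ shapeD⁺ ] ] ]
  where
  to : Av (3 + m) P4 π → A (3 + m) π ⊎ B (3 + m) π ⊎ C (3 + m) π ⊎ D (3 + m) π
  to av with π↭ , nsi ← Av⇒AvNSI av with Placement.classify (s≤s z≤n) π↭ nsi
  ... | startsWith0 π‼0≡0 = inj₁ (Av-image⁻ (shapeA⁻ (π↭ , nsi) π‼0≡0))
  ... | startsWith10 π‼0≡1 π‼1≡0 = inj₂ (inj₁ (Av-image⁻ (shapeB⁻ (π↭ , nsi) π‼0≡1 π‼1≡0)))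
  ... | endsWith0 _ π‼k≡0 = inj₂ (inj₂ (inj₁ (Av-image⁻ (shapeC⁻ (π↭ , nsi) π‼k≡0))))
  ... | startsWith20-ends1 _ π‼0≡2 π‼1≡0 π‼k≡1 =
    inj₂ (inj₂ (inj₂ (Av-image⁻ (shapeD⁻ (π↭ , nsi) π‼0≡2 π‼1≡0 π‼k≡1))))

A⇒¬B : ∀ {Q R π} → Image shapeA Q π → ¬ Image shapeB R π
A⇒¬B (_ , _ , refl) (_ , _ , ())

A⇒¬D : ∀ {Q R π} → Image shapeA Q π → ¬ Image shapeD R π
A⇒¬D (_ , _ , refl) (_ , _ , ())

B⇒¬D : ∀ {Q R π} → Image shapeB Q π → ¬ Image shapeD R π
B⇒¬D (_ , _ , refl) (_ , _ , ())

C-prefix : ∀ {m π} → C (3 + m) π → ∃ λ x → ∃ λ y → ∃ λ ρ → π ≡ suc x ∷ suc y ∷ ρ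
C-prefix ([]          , (σ↭ , _) , _) with () ← perm-length σ↭
C-prefix ((_ ∷ [])    , (σ↭ , _) , _) with () ← perm-length σ↭
C-prefix ((x ∷ y ∷ ρ) , _ , refl) =
  x , y , map (_+ 1) ρ ∷ʳ 0 , cong₂ _∷_ (+-comm x 1) (cong (_∷ map (_+ 1) ρ ∷ʳ 0) (+-comm y 1))

A⇒¬C : ∀ {m π} → A (3 + m) π → ¬ C (3 + m) π
A⇒¬C (_ , _ , refl) c with _ , _ , _ , () ← C-prefix c

B⇒¬C : ∀ {m π} → B (3 + m) π → ¬ C (3 + m) π
B⇒¬C (_ , _ , refl) c with _ , _ , _ , () ← C-prefix c

C⇒¬D : ∀ {m π} → C (3 + m) π → ¬ D (3 + m) π
C⇒¬D c (_ , _ , refl) with _ , _ , _ , () ← C-prefix c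

Enumeration : (List ℕ → Set) → ℕ → Set
Enumeration P k = Σ (List (List ℕ)) λ L → Unique L × (∀ π → (π ∈ L) ⇔ P π) × length L ≡ k

enumeration-resp : ∀ {P Q k} → (∀ π → P π ⇔ Q π) → Enumeration Q k → Enumeration P k
enumeration-resp P⇔Q (L , unique , ∈⇔Q , len) =
  L , unique , (λ π → mk⇔ (Equivalence.from (P⇔Q π) ∘ Equivalence.to (∈⇔Q π))
                          (Equivalence.from (∈⇔Q π) ∘ Equivalence.to (P⇔Q π))) , len

enumeration-singleton : ∀ {P} π₀ → (∀ π → P π ⇔ π ≡ π₀) → Enumeration P 1
enumeration-singleton π₀ P⇔ =
  π₀ ∷ [] , All.[] ∷ [] ,
  (λ π → mk⇔ (λ { (here refl) → Equivalence.from (P⇔ π) refl }) (here ∘ Equivalence.to (P⇔ π))) , refl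

enumeration-image : ∀ {Q k f} → Injective _≡_ _≡_ f → Enumeration Q k → Enumeration (Image f Q) k
enumeration-image {Q} {f = f} f-injective (L , unique , ∈⇔Q , len) =
  map f L , Unique.map⁺ f-injective unique , ∈⇔image , trans (length-map f L) len
  where
  ∈⇔image : ∀ π → (π ∈ map f L) ⇔ Image f Q π
  ∈⇔image π = mk⇔ to from
    where
    to : π ∈ map f L → Image f Q π
    to π∈ with σ , σ∈ , refl ← ∈-map⁻ f π∈ = σ , Equivalence.to (∈⇔Q σ) σ∈ , refl
    from : Image f Q π → π ∈ map f L
    from (σ , qσ , refl) = ∈-map⁺ f (Equivalence.from (∈⇔Q σ) qσ)

enumeration-⊎ : ∀ {P Q k l} → (∀ {π} → P π → ¬ Q π) → Enumeration P k → Enumeration Q l →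
                Enumeration (λ π → P π ⊎ Q π) (k + l)
enumeration-⊎ {P} {Q} disjoint (L₁ , unique₁ , ∈⇔P , len₁) (L₂ , unique₂ , ∈⇔Q , len₂) =
  L₁ ++ L₂ , Unique.++⁺ unique₁ unique₂ (λ (∈₁ , ∈₂) → disjoint (Equivalence.to (∈⇔P _) ∈₁) (Equivalence.to (∈⇔Q _) ∈₂)) ,
  ∈⇔⊎ , trans (length-++ L₁) (cong₂ _+_ len₁ len₂)
  where
  ∈⇔⊎ : ∀ π → (π ∈ L₁ ++ L₂) ⇔ (P π ⊎ Q π)
  ∈⇔⊎ π = mk⇔ to [ ∈-++⁺ˡ ∘ Equivalence.from (∈⇔P π) , ∈-++⁺ʳ L₁ ∘ Equivalence.from (∈⇔Q π) ]
    where
    to : π ∈ L₁ ++ L₂ → P π ⊎ Q π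
    to π∈ with ∈-++⁻ L₁ π∈
    ... | inj₁ π∈₁ = inj₁ (Equivalence.to (∈⇔P π) π∈₁)
    ... | inj₂ π∈₂ = inj₂ (Equivalence.to (∈⇔Q π) π∈₂)

+-injective : ∀ k → Injective _≡_ _≡_ (map (_+ k))
+-injective k = map-injective (+-cancelʳ-≡ k _ _)

shapeA-injective : Injective _≡_ _≡_ shapeA
shapeA-injective {σ} {τ} eq = +-injective 1 (∷-injectiveʳ (trans (sym (shapeA-≡ σ)) (trans eq (shapeA-≡ τ))))

shapeB-injective : Injective _≡_ _≡_ shapeB
shapeB-injective {σ} {τ} eq =
  +-injective 2 (∷-injectiveʳ (∷-injectiveʳ (trans (sym (shapeB-≡ σ)) (trans eq (shapeB-≡ τ)))))

shapeC-injective : Injective _≡_ _≡_ shapeC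
shapeC-injective {σ} {τ} eq = +-injective 1 (∷ʳ-injectiveˡ (map (_+ 1) σ) (map (_+ 1) τ) eq)

shapeD-injective : Injective _≡_ _≡_ shapeD
shapeD-injective {σ} {τ} eq =
  +-injective 3 (∷ʳ-injectiveˡ (map (_+ 3) σ) (map (_+ 3) τ) (∷-injectiveʳ (∷-injectiveʳ eq)))

Av-short : ∀ {k rels m π} → m ≤ k → Av m (pop (suc k) rels) π ⇔ IsPerm m π
Av-short {rels = rels} {π = π} m≤k =
  mk⇔ proj₁ (λ π↭ → π↭ , short-avoids rels π (subst (_≤ _) (sym (perm-length π↭)) m≤k))

Av-P4⇔Av-P3 : ∀ {m π} → m ≤ 2 → Av m P4 π ⇔ Av m P3 π
Av-P4⇔Av-P3 m≤2 = ⇔.trans (Av-short (m≤n⇒m≤1+n m≤2)) (⇔.sym (Av-short m≤2))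

Av-P3-enumeration : ∀ m → Enumeration (Av m P3) (fib (suc m))
Av-P3-enumeration zero =
  enumeration-singleton [] λ π → mk⇔ (↭-empty-inv ∘ Equivalence.to (Av-short z≤n))
                                       (λ { refl → Equivalence.from (Av-short z≤n) ↭-refl })
Av-P3-enumeration (suc zero) =
  enumeration-singleton (0 ∷ []) λ π → mk⇔ (↭-singleton-inv ∘ Equivalence.to (Av-short (s≤s z≤n)))
                                             (λ { refl → Equivalence.from (Av-short (s≤s z≤n)) ↭-refl })
Av-P3-enumeration (suc (suc m)) =
  enumeration-resp (Av-P3-decomposition m)
    (enumeration-⊎ A⇒¬B (enumeration-image shapeA-injective (Av-P3-enumeration (suc m)))
                        (enumeration-image shapeB-injective (Av-P3-enumeration m)))

-- a = F(j + 1), b = F(j + 2), so that b + a = F(j + 3)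
P4-count-step : ∀ j a b → (2 + j) * b + ((1 + j) * a + ((b + a) + a)) ≡ (3 + j) * (b + a)
P4-count-step = solve-∀

Av-P4-enumeration : ∀ k → Enumeration (Av (suc k) P4) (suc k * fib (suc k))
Av-P4-enumeration zero          = enumeration-resp (λ _ → Av-P4⇔Av-P3 (s≤s z≤n)) (Av-P3-enumeration 1)
Av-P4-enumeration (suc zero)    = enumeration-resp (λ _ → Av-P4⇔Av-P3 ≤-refl) (Av-P3-enumeration 2)
Av-P4-enumeration (suc (suc j)) =
  subst (Enumeration _) (P4-count-step j (fib (suc j)) (fib (suc (suc j))))
    (enumeration-resp (Av-P4-decomposition j)
      (enumeration-⊎ (λ a → [ A⇒¬B a , [ A⇒¬C a , A⇒¬D a ] ])
        (enumeration-image shapeA-injective (Av-P4-enumeration (suc j)))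
      (enumeration-⊎ (λ b → [ B⇒¬C b , B⇒¬D b ])
        (enumeration-image shapeB-injective (Av-P4-enumeration j))
      (enumeration-⊎ C⇒¬D
        (enumeration-image shapeC-injective (Av-P3-enumeration (suc (suc j))))
        (enumeration-image shapeD-injective (Av-P3-enumeration j))))))

mainTheorem16 :
  ((n : ℕ) → 1 ≤ n →
    Σ (List (List ℕ)) λ L →
      Unique L × (∀ π → (π ∈ L) ⇔ Av n P4 π) × length L ≡ n * fib n)
  ×
  ((n : ℕ) → 4 ≤ n →
    (∀ π → Av n P4 π ⇔ (A n π ⊎ B n π ⊎ C n π ⊎ D n π))
    × (∀ π → ¬ (A n π × B n π)) × (∀ π → ¬ (A n π × C n π))
    × (∀ π → ¬ (A n π × D n π)) × (∀ π → ¬ (B n π × C n π))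
    × (∀ π → ¬ (B n π × D n π)) × (∀ π → ¬ (C n π × D n π)))
mainTheorem16 =
  (λ { _ (s≤s {n = k} _) → Av-P4-enumeration k }) ,
  λ { _ (s≤s (s≤s (s≤s (s≤s {n = m} _)))) →
        Av-P4-decomposition (suc m)
      , (λ _ → uncurry A⇒¬B) , (λ _ → uncurry A⇒¬C) , (λ _ → uncurry A⇒¬D)
      , (λ _ → uncurry B⇒¬C) , (λ _ → uncurry B⇒¬D) , (λ _ → uncurry C⇒¬D) }
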